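{- Suppose that $(X;\overline E)$ is an $(I,w^{k+1})$-special $h$-structure, where $k=\max(I)$, and $f:X\to\omega$ is one-to-one on each $E_k$-class. Then there is $Y\subseteq X$ that induces an $(I,w)$-special $h$-substructure such that $f$ is one-to-one on $Y$.
   Context: For $1\leq h<\omega$, an $h$-structure $(X;\overline E)=(X;E_0,\dots,E_{h-1})$ consists of a nonempty finite set $X$ and equivalence relations $E_i$ on $X$ ($i<h$) with $E_0=X\times X$ and $E_i\supseteq E_{i+1}$ for $i<h-1$; by convention $E_h$ denotes the identity (discrete) relation on $X$. For $\varnothing\neq Y\subseteq X$, $Y$ induces the $h$-substructure $(Y;E_0\cap Y^2,\dots,E_{h-1}\cap Y^2)$. The $h$-structure is $(I,w)$-special if $w\geq 2$ and: (i) $I=\{i<h: E_i$ is not discrete and $i=\max\{j<h:E_j=E_i\}\}$; (ii) for every $i\in I$ and every $E_i$-class $A$, the number of $E_{i+1}$-classes contained in $A$ is at least $w$. -}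

module Defs where

open import Level using (0ℓ)
open import Data.Nat using (ℕ; zero; suc; _<_; _≤_; _<?_; _^_)
open import Data.Fin using (Fin; toℕ; fromℕ<)
open import Data.Fin.Subset using (Subset; _∈_)
open import Data.Product using (Σ; ∃; _×_)
open import Relation.Nullary using (¬_; yes; no)
open import Relation.Binary using (Rel; IsEquivalence; Decidable)
open import Relation.Binary.PropositionalEquality using (_≡_)

-- An h-structure on X = Fin n (n ≥ 1 is imposed where used; h ≥ 1 via h = suc h').
-- The relations E_i (i < h) are given as decidable equivalence relations
-- (X is finite, so this is no restriction classically).
record HStructure (n h : ℕ) : Set₁ where
  field
    E      : Fin h → Rel (Fin n) 0ℓ
    isEq   : ∀ i → IsEquivalence (E i)
    dec    : ∀ i → Decidable (E i)

  -- E_i for i : ℕ, with E_i = identity for i ≥ h (so E_h is discrete)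
  Eₙ : ℕ → Rel (Fin n) 0ℓ
  Eₙ i x y with i <? h
  ... | yes p = E (fromℕ< p) x y
  ... | no _  = x ≡ y

open HStructure public

IsHStructure : ∀ {n h'} → HStructure n (suc h') → Set
IsHStructure {n} {h'} S =
  (∀ (x y : Fin n) → Eₙ S 0 x y) ×
  (∀ (i : ℕ) → i < suc h' → ∀ (x y : Fin n) → Eₙ S (suc i) x y → Eₙ S i x y)

module _ {n h : ℕ} (S : HStructure n h) (Y : Subset n) where

  DiscreteOn : ℕ → Set
  DiscreteOn i = ∀ x y → x ∈ Y → y ∈ Y → Eₙ S i x y → x ≡ y

  SameOn : ℕ → ℕ → Set
  SameOn j i = ∀ x y → x ∈ Y → y ∈ Y →
    (Eₙ S j x y → Eₙ S i x y) × (Eₙ S i x y → Eₙ S j x y)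

  -- the E_i-class (within Y) of x contains at least w distinct E_{i+1}-classes:
  -- there are w elements of that class, pairwise E_{i+1}-inequivalent
  ManySubclasses : ℕ → ℕ → Fin n → Set
  ManySubclasses w i x =
    Σ (Fin w → Fin n) λ g →
      (∀ a → g a ∈ Y × Eₙ S i x (g a)) ×
      (∀ a b → Eₙ S (suc i) (g a) (g b) → a ≡ b)

  Special : Subset h → ℕ → Set
  Special I w =
    (2 ≤ w) ×
    ((∀ (i : Fin h) → i ∈ I →
        ¬ DiscreteOn (toℕ i) × (∀ (j : Fin h) → SameOn (toℕ j) (toℕ i) → toℕ j ≤ toℕ i)) ×
     (∀ (i : Fin h) →
        ¬ DiscreteOn (toℕ i) × (∀ (j : Fin h) → SameOn (toℕ j) (toℕ i) → toℕ j ≤ toℕ i) →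
        i ∈ I)) ×
    (∀ (i : Fin h) → i ∈ I → ∀ x → x ∈ Y → ManySubclasses w (toℕ i) x)

IsMax : ∀ {h} → Fin h → Subset h → Set
IsMax {h} k I = k ∈ I × (∀ (i : Fin h) → i ∈ I → toℕ i ≤ toℕ k)

{-# OPTIONS --safe #-}
module Submission where

-- Y is built top-down along the levels, as a list so that its size can be counted.
-- At the top level k, the w^(k+1) given E_(k+1)-subclasses of an E_k-class have
-- pairwise distinct f-values (f is injective on E_k-classes), so w of them can be
-- chosen avoiding any prescribed set of at most w^(k+1) - w values.  At a level
-- i ∈ I below k, pick w pairwise E_(i+1)-inequivalent points and build a piece under
-- each of them in turn, every piece avoiding the f-values already used; levels
-- outside I are passed through.  A piece started at level i has at most w^(k+1-i)
-- points, so no more than w^(k+1) values are ever used and every choice succeeds.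

open import Defs
open import Data.Nat using (ℕ; zero; suc; _^_; _+_; _*_; _≤_; _<_; _≤′_; ≤′-refl; ≤′-step; _<?_; _≤?_; z≤n; s≤s; NonZero; >-nonZero)
open import Data.Nat.Properties
open import Data.Fin using (Fin; toℕ; fromℕ<; zero; suc; inject≤)
import Data.Fin.Properties as Fin
open import Data.Fin.Subset using (Subset; _∈_; ⊤; ⋃; ⁅_⁆)
import Data.Fin.Subset.Properties as Subset
open import Data.Product using (Σ; ∃; ∃₂; _×_; _,_; proj₁; proj₂)
open import Data.Sum using (inj₁; inj₂)
open import Data.Empty using (⊥-elim)
open import Data.List using (List; []; _∷_; _++_; map; length; lookup; tabulate)
open import Data.List.Properties using (length-++; length-map; length-tabulate)
open import Data.List.Membership.Propositional using () renaming (_∈_ to _∈ₗ_; _∉_ to _∉ₗ_)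
open import Data.List.Membership.Propositional.Properties using (∈-map⁺; ∈-++⁺ˡ; ∈-++⁺ʳ; ∈-++⁻; ∈-tabulate⁺; ∈-tabulate⁻)
open import Data.List.Membership.DecPropositional _≟_ using (_∈?_)
open import Data.List.Relation.Binary.Subset.Propositional using (_⊆_)
open import Data.List.Relation.Unary.Any using (here; there; index)
open import Data.List.Relation.Unary.Any.Properties using (lookup-index)
open import Function using (_∘_; case_of_)
open import Relation.Nullary using (¬_; yes; no; Dec)
open import Relation.Binary using (IsEquivalence)
open import Relation.Binary.PropositionalEquality using (_≡_; _≢_; refl; sym; trans; cong; subst; ≢-sym; module ≡-Reasoning)

module _ {W : ℕ} (v : Fin W → ℕ) (v-injective : ∀ a b → v a ≡ v b → a ≡ b) where

  ∃-∉ : (G : List ℕ) → length G < W → ∃ λ a → v a ∉ₗ G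
  ∃-∉ G |G|<W = Fin.¬∀⟶∃¬ W (λ a → v a ∈ₗ G) (λ a → v a ∈? G) not-all
    where
    not-all : ¬ (∀ a → v a ∈ₗ G)
    not-all v∈G with Fin.pigeonhole |G|<W (index ∘ v∈G)
    ... | a , b , a<b , same-index = Fin.<⇒≢ a<b (v-injective a b (begin
      v a                         ≡⟨ lookup-index (v∈G a) ⟩
      lookup G (index (v∈G a))    ≡⟨ cong (lookup G) same-index ⟩
      lookup G (index (v∈G b))    ≡⟨ lookup-index (v∈G b) ⟨
      v b                         ∎))
      where open ≡-Reasoning

  length-++-tabulate< : ∀ {w} F (σ : Fin w → Fin W) → length F + suc w ≤ W →
    length (F ++ tabulate (v ∘ σ)) < W
  length-++-tabulate< {w} F σ budget = begin-strict
    length (F ++ tabulate (v ∘ σ))          ≡⟨ length-++ F ⟩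
    length F + length (tabulate (v ∘ σ))    ≡⟨ cong (length F +_) (length-tabulate (v ∘ σ)) ⟩
    length F + w                            <⟨ +-monoʳ-< (length F) (n<1+n w) ⟩
    length F + suc w                        ≤⟨ budget ⟩
    W                                       ∎
    where open ≤-Reasoning

  select-avoiding : ∀ w (F : List ℕ) → length F + w ≤ W →
    Σ (Fin w → Fin W) λ σ → (∀ a b → σ a ≡ σ b → a ≡ b) × (∀ a → v (σ a) ∉ₗ F)
  select-avoiding zero F _ = (λ ()) , (λ ()) , (λ ())
  select-avoiding (suc w) F budget
    with σ , σ-injective , σ-avoids ← select-avoiding w F (≤-trans (+-monoʳ-≤ (length F) (n≤1+n w)) budget)
    with a , a-new ← ∃-∉ (F ++ tabulate (v ∘ σ)) (length-++-tabulate< F σ budget)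
    = σ′ , σ′-injective , σ′-avoids
    where
    σ′ : Fin (suc w) → Fin W
    σ′ zero = a
    σ′ (suc b) = σ b
    a∉σ : ∀ b → a ≢ σ b
    a∉σ b refl = a-new (∈-++⁺ʳ F (∈-tabulate⁺ b))
    σ′-injective : ∀ b c → σ′ b ≡ σ′ c → b ≡ c
    σ′-injective zero zero _ = refl
    σ′-injective zero (suc c) e = ⊥-elim (a∉σ c e)
    σ′-injective (suc b) zero e = ⊥-elim (a∉σ b (sym e))
    σ′-injective (suc b) (suc c) e = cong suc (σ-injective b c e)
    σ′-avoids : ∀ b → v (σ′ b) ∉ₗ F
    σ′-avoids zero p = a-new (∈-++⁺ˡ p)
    σ′-avoids (suc b) = σ-avoids b

module _ {A : Set} (f : A → ℕ) where

  InjectiveOn : List A → Set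
  InjectiveOn Y = ∀ {y z} → y ∈ₗ Y → z ∈ₗ Y → f y ≡ f z → y ≡ z

  Avoids : List ℕ → List A → Set
  Avoids F Y = ∀ {y} → y ∈ₗ Y → f y ∉ₗ F

  injectiveOn-++ : ∀ {Y Z} → InjectiveOn Y → InjectiveOn Z → Avoids (map f Z) Y → InjectiveOn (Y ++ Z)
  injectiveOn-++ {Y} {Z} inj-Y inj-Z Y-avoids-Z p q e with ∈-++⁻ Y p | ∈-++⁻ Y q
  ... | inj₁ p | inj₁ q = inj-Y p q e
  ... | inj₂ p | inj₂ q = inj-Z p q e
  ... | inj₁ p | inj₂ q = ⊥-elim (Y-avoids-Z p (subst (_∈ₗ map f Z) (sym e) (∈-map⁺ f q)))
  ... | inj₂ p | inj₁ q = ⊥-elim (Y-avoids-Z q (subst (_∈ₗ map f Z) e (∈-map⁺ f p)))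

  avoids-++ : ∀ {F Y Z} → Avoids F Y → Avoids F Z → Avoids F (Y ++ Z)
  avoids-++ {Y = Y} F-Y F-Z p with ∈-++⁻ Y p
  ... | inj₁ p = F-Y p
  ... | inj₂ p = F-Z p

  avoids-++ˡ : ∀ {F G Y} → Avoids (F ++ G) Y → Avoids F Y
  avoids-++ˡ avoids p = avoids p ∘ ∈-++⁺ˡ

  avoids-++ʳ : ∀ {F G Y} → Avoids (F ++ G) Y → Avoids G Y
  avoids-++ʳ {F} avoids p = avoids p ∘ ∈-++⁺ʳ F

toSubset : ∀ {n} → List (Fin n) → Subset n
toSubset = ⋃ ∘ map ⁅_⁆

toSubset⁺ : ∀ {n} {y : Fin n} {ys} → y ∈ₗ ys → y ∈ toSubset ys
toSubset⁺ {y = y} (here refl) = Subset.x∈p∪q⁺ (inj₁ (Subset.x∈⁅x⁆ y))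
toSubset⁺ (there p) = Subset.x∈p∪q⁺ (inj₂ (toSubset⁺ p))

toSubset⁻ : ∀ {n} {y : Fin n} ys → y ∈ toSubset ys → y ∈ₗ ys
toSubset⁻ [] p = ⊥-elim (Subset.∉⊥ p)
toSubset⁻ (z ∷ zs) p with Subset.x∈p∪q⁻ ⁅ z ⁆ (toSubset zs) p
... | inj₁ q = here (Subset.x∈⁅y⁆⇒x≡y z q)
... | inj₂ q = there (toSubset⁻ zs q)

module _ {n h} (S : HStructure n h) where

  Eₙ-refl : ∀ i {x} → Eₙ S i x x
  Eₙ-refl i with i <? h
  ... | yes i<h = IsEquivalence.refl (isEq S (fromℕ< i<h))
  ... | no _ = refl

  Eₙ-sym : ∀ i {x y} → Eₙ S i x y → Eₙ S i y x
  Eₙ-sym i e with i <? h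
  ... | yes i<h = IsEquivalence.sym (isEq S (fromℕ< i<h)) e
  ... | no _ = sym e

  Eₙ-trans : ∀ i {x y z} → Eₙ S i x y → Eₙ S i y z → Eₙ S i x z
  Eₙ-trans i e e′ with i <? h
  ... | yes i<h = IsEquivalence.trans (isEq S (fromℕ< i<h)) e e′
  ... | no _ = trans e e′

  Eₙ-discrete : ∀ i {x y} → ¬ i < h → Eₙ S i x y → x ≡ y
  Eₙ-discrete i i≮h e with i <? h
  ... | yes i<h = ⊥-elim (i≮h i<h)
  ... | no _ = e

  manySubclasses-≤ : ∀ {Y w v i x} → w ≤ v → ManySubclasses S Y v i x → ManySubclasses S Y w i x
  manySubclasses-≤ w≤v (g , g-in , g-apart) =
    g ∘ (λ a → inject≤ a w≤v) , g-in ∘ (λ a → inject≤ a w≤v) ,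
    λ a b e → Fin.inject≤-injective w≤v w≤v a b (g-apart _ _ e)

module _ {n h'} (S : HStructure n (suc h')) (hS : IsHStructure S) where

  Eₙ-suc⇒Eₙ : ∀ i {x y} → Eₙ S (suc i) x y → Eₙ S i x y
  Eₙ-suc⇒Eₙ i {x} {y} e = from (i <? suc h')
    where
    from : Dec (i < suc h') → Eₙ S i x y
    from (yes i<h) = proj₂ hS i i<h x y e
    from (no i≮h) = subst (Eₙ S i x) (Eₙ-discrete S (suc i) (i≮h ∘ <-trans (n<1+n i)) e) (Eₙ-refl S i)

  Eₙ-antitone′ : ∀ {i j x y} → i ≤′ j → Eₙ S j x y → Eₙ S i x y
  Eₙ-antitone′ ≤′-refl e = e
  Eₙ-antitone′ (≤′-step i≤′j) e = Eₙ-antitone′ i≤′j (Eₙ-suc⇒Eₙ _ e)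

  Eₙ-antitone : ∀ {i j x y} → i ≤ j → Eₙ S j x y → Eₙ S i x y
  Eₙ-antitone = Eₙ-antitone′ ∘ ≤⇒≤′

  separated-pair : ∀ {Y w i x} → 2 ≤ w → ManySubclasses S Y w i x →
    ∃₂ λ y z → y ∈ Y × z ∈ Y × Eₙ S i y z × ¬ Eₙ S (suc i) y z
  separated-pair {i = i} (s≤s (s≤s _)) (g , g-in , g-apart) =
    g zero , g (suc zero) , proj₁ (g-in zero) , proj₁ (g-in (suc zero)) ,
    Eₙ-trans S i (Eₙ-sym S i (proj₂ (g-in zero))) (proj₂ (g-in (suc zero))) ,
    λ e → case g-apart zero (suc zero) e of λ ()

  special-of-manySubclasses : ∀ {I W w} (Y : Subset n) → Special S ⊤ I W → 2 ≤ w → ∃ (_∈ Y) →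
    (∀ i → i ∈ I → ∀ x → x ∈ Y → ManySubclasses S Y w (toℕ i) x) → Special S Y I w
  special-of-manySubclasses {I} Y (_ , (_ , I-complete) , _) 2≤w (x , x∈Y) many =
    2≤w , ((λ i i∈I → not-discrete i i∈I , maximal i i∈I) , complete) , many
    where
    not-discrete : ∀ i → i ∈ I → ¬ DiscreteOn S Y (toℕ i)
    not-discrete i i∈I discrete
      with y , z , y∈Y , z∈Y , Ei-yz , ¬Esuc-yz ← separated-pair 2≤w (many i i∈I x x∈Y)
      = ¬Esuc-yz (subst (Eₙ S (suc (toℕ i)) y) (discrete y z y∈Y z∈Y Ei-yz) (Eₙ-refl S (suc (toℕ i))))

    maximal : ∀ i → i ∈ I → ∀ j → SameOn S Y (toℕ j) (toℕ i) → toℕ j ≤ toℕ i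
    maximal i i∈I j same with toℕ j ≤? toℕ i
    ... | yes j≤i = j≤i
    ... | no j≰i
      with y , z , y∈Y , z∈Y , Ei-yz , ¬Esuc-yz ← separated-pair 2≤w (many i i∈I x x∈Y)
      = ⊥-elim (¬Esuc-yz (Eₙ-antitone (≰⇒> j≰i) (proj₂ (same y z y∈Y z∈Y) Ei-yz)))

    complete : ∀ i → ¬ DiscreteOn S Y (toℕ i) × (∀ j → SameOn S Y (toℕ j) (toℕ i) → toℕ j ≤ toℕ i) → i ∈ I
    complete i (not-discrete , maximal) = I-complete i
      ( (λ discrete → not-discrete (λ y z _ _ → discrete y z Subset.∈⊤ Subset.∈⊤))
      , (λ j same → maximal j (λ y z _ _ → same y z Subset.∈⊤ Subset.∈⊤)))

module Construction {n h'} (S : HStructure n (suc h')) (hS : IsHStructure S)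
  (I : Subset (suc h')) (k : Fin (suc h')) (w : ℕ) (k-max : IsMax k I)
  (spec : Special S ⊤ I (w ^ suc (toℕ k)))
  (f : Fin n → ℕ) (f-injective : ∀ x y → Eₙ S (toℕ k) x y → f x ≡ f y → x ≡ y) where

  X : Set
  X = Fin n

  K W : ℕ
  K = toℕ k
  W = w ^ suc K

  2≤w : 2 ≤ w
  2≤w with 2 ≤? w
  ... | yes 2≤w = 2≤w
  ... | no 2≰w = case ≤-trans (proj₁ spec) W≤1 of λ { (s≤s ()) }
    where
    W≤1 : W ≤ 1
    W≤1 = subst (W ≤_) (^-zeroˡ (suc K)) (^-monoˡ-≤ (suc K) (≤-pred (≰⇒> 2≰w)))

  0<w : 0 < w
  0<w = ≤-trans (s≤s z≤n) 2≤w

  instance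
    w-nonZero : NonZero w
    w-nonZero = >-nonZero 0<w

  w≤W : w ≤ W
  w≤W = m≤m*n w (w ^ K) {{m^n≢0 w K}}

  ManySubclassesIn : List X → ℕ → X → Set
  ManySubclassesIn Y i y = Σ (Fin w → X) λ g →
    (∀ a → g a ∈ₗ Y × Eₙ S i y (g a)) × (∀ a b → Eₙ S (suc i) (g a) (g b) → a ≡ b)

  manySubclassesIn-mono : ∀ {Y Z i y} → Y ⊆ Z → ManySubclassesIn Y i y → ManySubclassesIn Z i y
  manySubclassesIn-mono Y⊆Z (g , g-in , g-apart) = g , (λ a → Y⊆Z (proj₁ (g-in a)) , proj₂ (g-in a)) , g-apart

  manySubclassesIn⇒manySubclasses : ∀ {Y i y} → ManySubclassesIn Y i y → ManySubclasses S (toSubset Y) w i y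
  manySubclassesIn⇒manySubclasses (g , g-in , g-apart) = g , (λ a → toSubset⁺ (proj₁ (g-in a)) , proj₂ (g-in a)) , g-apart

  BranchesFrom : ℕ → List X → Set
  BranchesFrom i Y = ∀ j → j ∈ I → i ≤ toℕ j → ∀ {y} → y ∈ₗ Y → ManySubclassesIn Y (toℕ j) y

  branchesFrom-++ : ∀ {i Y Z} → BranchesFrom i Y → BranchesFrom i Z → BranchesFrom i (Y ++ Z)
  branchesFrom-++ {Y = Y} Y-branches Z-branches j j∈I i≤j p with ∈-++⁻ Y p
  ... | inj₁ p = manySubclassesIn-mono ∈-++⁺ˡ (Y-branches j j∈I i≤j p)
  ... | inj₂ p = manySubclassesIn-mono (∈-++⁺ʳ Y) (Z-branches j j∈I i≤j p)

  -- F holds the f-values already taken by the rest of the set under construction.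
  record Tree (i s : ℕ) (x : X) (F : List ℕ) (Y : List X) : Set where
    field
      nonempty  : ∃ (_∈ₗ Y)
      below     : ∀ {y} → y ∈ₗ Y → Eₙ S i x y
      injective : InjectiveOn f Y
      avoids    : Avoids f F Y
      size      : length Y ≤ s
      branches  : BranchesFrom i Y

  record Forest (i s c : ℕ) (x : X) (roots : Fin c → X) (F : List ℕ) (Y : List X) : Set where
    field
      covers    : ∀ a → ∃ λ y → y ∈ₗ Y × Eₙ S (suc i) (roots a) y
      below     : ∀ {y} → y ∈ₗ Y → Eₙ S i x y
      injective : InjectiveOn f Y
      avoids    : Avoids f F Y
      size      : length Y ≤ c * s
      branches  : BranchesFrom (suc i) Y

  f-separates-subclasses : ∀ {v x} (g : Fin v → X) → (∀ a → Eₙ S K x (g a)) →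
    (∀ a b → Eₙ S (suc K) (g a) (g b) → a ≡ b) → ∀ a b → f (g a) ≡ f (g b) → a ≡ b
  f-separates-subclasses g x-g g-apart a b e = g-apart a b (subst (Eₙ S (suc K) (g a))
    (f-injective (g a) (g b) (Eₙ-trans S K (Eₙ-sym S K (x-g a)) (x-g b)) e) (Eₙ-refl S (suc K)))

  tree-base : ∀ x F → length F + w ≤ W → Σ (List X) (Tree K w x F)
  tree-base x F budget
    with g , g-in , g-apart ← proj₂ (proj₂ spec) k (proj₁ k-max) x Subset.∈⊤
    with σ , σ-injective , σ-avoids ←
           select-avoiding (f ∘ g) (f-separates-subclasses g (proj₂ ∘ g-in) g-apart) w F budget
    = tabulate chosen , record
    { nonempty  = chosen a₀ , ∈-tabulate⁺ a₀
    ; below     = λ p → case ∈-tabulate⁻ p of λ { (a , refl) → x-g (σ a) }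
    ; injective = injective
    ; avoids    = λ p → case ∈-tabulate⁻ p of λ { (a , refl) → σ-avoids a }
    ; size      = ≤-reflexive (length-tabulate chosen)
    ; branches  = branches
    }
    where
    x-g : ∀ a → Eₙ S K x (g a)
    x-g = proj₂ ∘ g-in

    chosen : Fin w → X
    chosen = g ∘ σ

    a₀ : Fin w
    a₀ = fromℕ< 0<w

    injective : InjectiveOn f (tabulate chosen)
    injective p q e with ∈-tabulate⁻ p | ∈-tabulate⁻ q
    ... | a , refl | b , refl =
      cong chosen (σ-injective a b (f-separates-subclasses g x-g g-apart (σ a) (σ b) e))

    branches : BranchesFrom K (tabulate chosen)
    branches j j∈I K≤j p rewrite ≤-antisym (proj₂ k-max j j∈I) K≤j with ∈-tabulate⁻ p
    ... | a , refl = chosen , (λ b → ∈-tabulate⁺ b , Eₙ-trans S K (Eₙ-sym S K (x-g (σ a))) (x-g (σ b))) ,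
                     λ b c e → σ-injective b c (g-apart (σ b) (σ c) e)

  tree-lift : ∀ {i s x F Y} → (∀ j → j ∈ I → toℕ j ≢ i) → Tree (suc i) s x F Y → Tree i s x F Y
  tree-lift {i} i∉I t = record
    { nonempty  = Tree.nonempty t
    ; below     = λ p → Eₙ-suc⇒Eₙ S hS i (Tree.below t p)
    ; injective = Tree.injective t
    ; avoids    = Tree.avoids t
    ; size      = Tree.size t
    ; branches  = λ j j∈I i≤j → Tree.branches t j j∈I (≤∧≢⇒< i≤j (≢-sym (i∉I j j∈I)))
    }

  tree-resize : ∀ {i s s′ x F Y} → s ≤ s′ → Tree i s x F Y → Tree i s′ x F Y
  tree-resize s≤s′ t = record
    { nonempty  = Tree.nonempty t
    ; below     = Tree.below t
    ; injective = Tree.injective t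
    ; avoids    = Tree.avoids t
    ; size      = ≤-trans (Tree.size t) s≤s′
    ; branches  = Tree.branches t
    }

  forest-nil : ∀ {i s x roots F} → Forest i s 0 x roots F []
  forest-nil = record
    { covers = λ (); below = λ (); injective = λ (); avoids = λ (); size = z≤n; branches = λ _ _ _ () }

  forest-cons : ∀ {i s c x roots F Y Z} → Eₙ S i x (roots zero) →
    Tree (suc i) s (roots zero) (F ++ map f Z) Y → Forest i s c x (roots ∘ suc) F Z →
    Forest i s (suc c) x roots F (Y ++ Z)
  forest-cons {i} {roots = roots} {F} {Y} {Z} x-root t φ = record
    { covers    = covers
    ; below     = below
    ; injective = injectiveOn-++ f (Tree.injective t) (Forest.injective φ) (avoids-++ʳ f {F} (Tree.avoids t))
    ; avoids    = avoids-++ f (avoids-++ˡ f (Tree.avoids t)) (Forest.avoids φ)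
    ; size      = subst (_≤ _) (sym (length-++ Y)) (+-mono-≤ (Tree.size t) (Forest.size φ))
    ; branches  = branchesFrom-++ (Tree.branches t) (Forest.branches φ)
    }
    where
    covers : ∀ a → ∃ λ y → y ∈ₗ Y ++ Z × Eₙ S (suc i) (roots a) y
    covers zero with y , y∈Y ← Tree.nonempty t = y , ∈-++⁺ˡ y∈Y , Tree.below t y∈Y
    covers (suc a) with y , y∈Z , root-y ← Forest.covers φ a = y , ∈-++⁺ʳ Y y∈Z , root-y
    below : ∀ {y} → y ∈ₗ Y ++ Z → Eₙ S i _ y
    below p with ∈-++⁻ Y p
    ... | inj₁ p = Eₙ-trans S i x-root (Eₙ-suc⇒Eₙ S hS i (Tree.below t p))
    ... | inj₂ p = Forest.below φ p

  budget-++ : ∀ {s c} F Z → length Z ≤ c * s → length F + suc c * s ≤ W → length (F ++ map f Z) + s ≤ W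
  budget-++ {s} {c} F Z |Z|≤cs budget = begin
    length (F ++ map f Z) + s      ≡⟨ cong (_+ s) (trans (length-++ F) (cong (length F +_) (length-map f Z))) ⟩
    length F + length Z + s        ≡⟨ +-assoc (length F) (length Z) s ⟩
    length F + (length Z + s)      ≤⟨ +-monoʳ-≤ (length F) (+-monoˡ-≤ s |Z|≤cs) ⟩
    length F + (c * s + s)         ≡⟨ cong (length F +_) (+-comm (c * s) s) ⟩
    length F + suc c * s           ≤⟨ budget ⟩
    W                              ∎
    where open ≤-Reasoning

  forest : ∀ {i s} → (∀ x F → length F + s ≤ W → Σ (List X) (Tree (suc i) s x F)) →
    ∀ {c x} (roots : Fin c → X) → (∀ a → Eₙ S i x (roots a)) →
    ∀ F → length F + c * s ≤ W → Σ (List X) (Forest i s c x roots F)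
  forest tree {zero} roots _ F _ = [] , forest-nil
  forest {s = s} tree {suc c} roots x-roots F budget
    with Z , φ ← forest tree (roots ∘ suc) (x-roots ∘ suc) F (≤-trans (+-monoʳ-≤ (length F) (m≤n+m (c * s) s)) budget)
    with Y , t ← tree (roots zero) (F ++ map f Z) (budget-++ {s} {c} F Z (Forest.size φ) budget)
    = Y ++ Z , forest-cons (x-roots zero) t φ

  forest⇒tree : ∀ {i s x roots F Y} → (∀ a b → Eₙ S (suc i) (roots a) (roots b) → a ≡ b) →
    (∀ a → Eₙ S i x (roots a)) → Forest i s w x roots F Y → Tree i (w * s) x F Y
  forest⇒tree {i} {roots = roots} {Y = Y} roots-apart x-roots φ = record
    { nonempty  = proj₁ (Forest.covers φ (fromℕ< 0<w)) , proj₁ (proj₂ (Forest.covers φ (fromℕ< 0<w)))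
    ; below     = Forest.below φ
    ; injective = Forest.injective φ
    ; avoids    = Forest.avoids φ
    ; size      = Forest.size φ
    ; branches  = branches
    }
    where
    rep : Fin w → X
    rep a = proj₁ (Forest.covers φ a)
    root-rep : ∀ a → Eₙ S (suc i) (roots a) (rep a)
    root-rep a = proj₂ (proj₂ (Forest.covers φ a))

    many : ∀ {y} → y ∈ₗ Y → ManySubclassesIn Y i y
    many y∈Y = rep , (λ a → proj₁ (proj₂ (Forest.covers φ a)) ,
        Eₙ-trans S i (Eₙ-sym S i (Forest.below φ y∈Y)) (Eₙ-trans S i (x-roots a) (Eₙ-suc⇒Eₙ S hS i (root-rep a)))) ,
      λ a b e → roots-apart a b (Eₙ-trans S (suc i) (root-rep a) (Eₙ-trans S (suc i) e (Eₙ-sym S (suc i) (root-rep b))))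

    branches : BranchesFrom i Y
    branches j j∈I i≤j y∈Y with toℕ j ≟ i
    ... | yes refl = many y∈Y
    ... | no j≢i = Forest.branches φ j j∈I (≤∧≢⇒< i≤j (≢-sym j≢i)) y∈Y

  level<h : ∀ {i t} → i + t ≡ K → i < suc h'
  level<h {i} {t} i+t≡K = ≤-<-trans (subst (i ≤_) i+t≡K (m≤m+n i t)) (Fin.toℕ<n k)

  trees : ∀ t i → i + t ≡ K → ∀ x F → length F + w ^ suc t ≤ W → Σ (List X) (Tree i (w ^ suc t) x F)
  trees zero i i+0≡K x F budget rewrite ^-identityʳ w | trans (sym (+-identityʳ i)) i+0≡K = tree-base x F budget
  trees (suc t) i i+1+t≡K x F budget = split (fromℕ< i<h Subset.∈? I)
    where
    i<h : i < suc h'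
    i<h = level<h i+1+t≡K

    s : ℕ
    s = w ^ suc t

    subtrees : ∀ x F → length F + s ≤ W → Σ (List X) (Tree (suc i) s x F)
    subtrees = trees t (suc i) (trans (sym (+-suc i t)) i+1+t≡K)

    subclasses : fromℕ< i<h ∈ I → ManySubclasses S ⊤ w i x
    subclasses i∈I = manySubclasses-≤ S w≤W
      (subst (λ l → ManySubclasses S ⊤ W l x) (Fin.toℕ-fromℕ< i<h) (proj₂ (proj₂ spec) _ i∈I x Subset.∈⊤))

    split : Dec (fromℕ< i<h ∈ I) → Σ (List X) (Tree i (w * s) x F)
    split (no i∉I) with Y , τ ← subtrees x F (≤-trans (+-monoʳ-≤ (length F) (m≤n*m s w)) budget) =
      Y , tree-lift (λ j j∈I j≡i → i∉I (subst (_∈ I) (Fin.toℕ-injective (trans j≡i (sym (Fin.toℕ-fromℕ< i<h)))) j∈I))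
                    (tree-resize (m≤n*m s w) τ)
    split (yes i∈I)
      with g , g-in , g-apart ← subclasses i∈I
      with Y , φ ← forest subtrees g (proj₂ ∘ g-in) F budget
      = Y , forest⇒tree g-apart (proj₂ ∘ g-in) φ

lemma3p4 : ∀ {m h'} (S : HStructure (suc m) (suc h')) → IsHStructure S →
    (I : Subset (suc h')) (k : Fin (suc h')) (w : ℕ) → IsMax k I →
    Special S ⊤ I (w ^ suc (toℕ k)) →
    (f : Fin (suc m) → ℕ) →
    (∀ x y → Eₙ S (toℕ k) x y → f x ≡ f y → x ≡ y) →
    Σ (Subset (suc m)) λ Y → (∃ λ x → x ∈ Y) × Special S Y I w ×
    (∀ x y → x ∈ Y → y ∈ Y → f x ≡ f y → x ≡ y)
lemma3p4 S hS I k w k-max spec f f-injective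
  with Y , τ ← Construction.trees S hS I k w k-max spec f f-injective (toℕ k) 0 refl zero [] ≤-refl
  = toSubset Y , point , special-of-manySubclasses S hS (toSubset Y) spec 2≤w point many ,
    λ x y x∈Y y∈Y → Tree.injective τ (toSubset⁻ Y x∈Y) (toSubset⁻ Y y∈Y)
  where
  open Construction S hS I k w k-max spec f f-injective
  point : ∃ (_∈ toSubset Y)
  point = proj₁ (Tree.nonempty τ) , toSubset⁺ (proj₂ (Tree.nonempty τ))
  many : ∀ i → i ∈ I → ∀ x → x ∈ toSubset Y → ManySubclasses S (toSubset Y) w (toℕ i) x
  many i i∈I x x∈Y = manySubclassesIn⇒manySubclasses (Tree.branches τ i i∈I z≤n (toSubset⁻ Y x∈Y))
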